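{- For all integers $d,m\ge1$ there exists a non-copying $\mathrm{MSO}_1$ transduction $\sigma_{d,m}$ such that the following holds: if $r$ is an integer and $G\in\mathrm{TM}_d^m$ is a graph such that the underlying rooted tree of every tree-model of $G$ with $m$ colours and depth $d$ contains $\overline T_d^{\,r}$ as a rooted subtree, then $\overline T_d^{\,r-1}\in\sigma_{d,m}(G)$ (up to isomorphism).
   Context: All graphs are finite, simple and undirected. A tree-model of $m$ colours and depth $d$ of a graph $G$ is a rooted tree $T$ with a set $S\subseteq\{1,\dots,m\}^2\times\{1,\dots,d\}$ such that: every root-to-leaf path has length exactly $d$; the leaves are exactly $V(G)$; each leaf gets one of colours $1,\dots,m$; $(i,j,\ell)\in S$ iff $(j,i,\ell)\in S$; and for distinct $u,v\in V(G)$ coloured $i,j$ at distance $2\ell$ in $T$, $uv\in E(G)$ iff $(i,j,\ell)\in S$. $\mathrm{TM}_d^m$ is the class of such graphs. $\overline T_d^{\,r}$ denotes the complete rooted $r$-ary tree of height $d$ (regarded as a graph); a rooted tree $U$ contains it as a rooted subtree if some subtree of $U$ containing the root of $U$ is isomorphic to $\overline T_d^{\,r}$ via an isomorphism mapping root to root. $\mathrm{MSO}_1$ logic over vertex-labelled graphs: vertex and vertex-set variables, equality, quantifiers over vertices and sets, Boolean connectives, membership, the edge predicate and unary label predicates. A non-copying $\mathrm{MSO}_1$ transduction $\sigma$ maps a graph $G$ to the set of all graphs obtained as follows: expand $G$ by $p$ arbitrary unary predicates (fixed $p$), and if the expanded structure $A$ satisfies a fixed $\mathrm{MSO}_1$ sentence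 $\chi$, output the graph with vertices $\{v:A\models\nu(v)\}$ and edges $\{u,v\}$, $u\neq v$, with $A\models\nu(u)\wedge\nu(v)\wedge\mu(u,v)$, for fixed $\mathrm{MSO}_1$ formulas $\nu$ (one free variable) and symmetric $\mu$ (two free variables). -}

module Defs where

open import Data.Nat using (ℕ; zero; suc; _≤_)
open import Data.Fin using (Fin; zero; suc; toℕ; _≟_)
open import Data.Bool using (Bool; true; false; not; _∧_; _∨_; if_then_else_)
open import Data.List using (List; []; _∷_; length; allFin; concatMap)
open import Data.Bool.ListAction using (any)
open import Data.List.Properties using (≡-dec)
open import Data.Vec using (Vec; []; _∷_; lookup)
open import Data.Product using (Σ; ∃; _×_; _,_; proj₁)
open import Data.Unit using (⊤)
open import Relation.Nullary using (¬_)
open import Relation.Nullary.Decidable using (⌊_⌋)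
open import Relation.Binary.PropositionalEquality using (_≡_)
open import Function.Bundles using (_↔_; Inverse)

record Graph : Set where
  field
    n     : ℕ
    adj   : Fin n → Fin n → Bool
    sym   : ∀ u v → adj u v ≡ adj v u
    irrefl : ∀ v → adj v v ≡ false
open Graph public

Iso : {V W : Set} → (V → V → Bool) → (W → W → Bool) → Set
Iso {V} {W} adjV adjW =
  Σ (V ↔ W) λ f → ∀ u v → adjV u v ≡ adjW (Inverse.to f u) (Inverse.to f v)

-- MSO₁ over vertex-labelled graphs with p unary label predicates.
-- Form p k s : formulas with k free vertex variables and s free
-- vertex-set variables (de Bruijn indices).

data Form (p : ℕ) : ℕ → ℕ → Set where
  eq   : ∀ {k s} → Fin k → Fin k → Form p k s
  edge : ∀ {k s} → Fin k → Fin k → Form p k s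
  mem  : ∀ {k s} → Fin k → Fin s → Form p k s
  lab  : ∀ {k s} → Fin p → Fin k → Form p k s
  neg  : ∀ {k s} → Form p k s → Form p k s
  and  : ∀ {k s} → Form p k s → Form p k s → Form p k s
  or   : ∀ {k s} → Form p k s → Form p k s → Form p k s
  ex1  : ∀ {k s} → Form p (suc k) s → Form p k s
  all1 : ∀ {k s} → Form p (suc k) s → Form p k s
  exS  : ∀ {k s} → Form p k (suc s) → Form p k s
  allS : ∀ {k s} → Form p k (suc s) → Form p k s

allSubsets : ∀ n → List (Fin n → Bool)
allSubsets zero = (λ ()) ∷ []
allSubsets (suc n) = concatMap (λ X → ext false X ∷ ext true X ∷ []) (allSubsets n)
  where
  ext : Bool → (Fin n → Bool) → Fin (suc n) → Bool
  ext b X zero = b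
  ext b X (suc i) = X i

allL : {A : Set} → (A → Bool) → List A → Bool
allL f xs = not (any (λ x → not (f x)) xs)

eval : ∀ {p k s} (G : Graph) (lb : Fin p → Fin (n G) → Bool) →
       Form p k s → Vec (Fin (n G)) k → Vec (Fin (n G) → Bool) s → Bool
eval G lb (eq i j)   ρ σ = ⌊ lookup ρ i ≟ lookup ρ j ⌋
eval G lb (edge i j) ρ σ = adj G (lookup ρ i) (lookup ρ j)
eval G lb (mem i X)  ρ σ = lookup σ X (lookup ρ i)
eval G lb (lab a i)  ρ σ = lb a (lookup ρ i)
eval G lb (neg φ)    ρ σ = not (eval G lb φ ρ σ)
eval G lb (and φ ψ)  ρ σ = eval G lb φ ρ σ ∧ eval G lb ψ ρ σ
eval G lb (or φ ψ)   ρ σ = eval G lb φ ρ σ ∨ eval G lb ψ ρ σ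
eval G lb (ex1 φ)    ρ σ = any  (λ v → eval G lb φ (v ∷ ρ) σ) (allFin (n G))
eval G lb (all1 φ)   ρ σ = allL (λ v → eval G lb φ (v ∷ ρ) σ) (allFin (n G))
eval G lb (exS φ)    ρ σ = any  (λ X → eval G lb φ ρ (X ∷ σ)) (allSubsets (n G))
eval G lb (allS φ)   ρ σ = allL (λ X → eval G lb φ ρ (X ∷ σ)) (allSubsets (n G))

record Transduction : Set where
  field
    p : ℕ
    χ : Form p 0 0
    ν : Form p 1 0
    μ : Form p 2 0
    μ-sym : ∀ (G : Graph) (lb : Fin p → Fin (n G) → Bool) (u v : Fin (n G)) →
            eval G lb μ (u ∷ v ∷ []) [] ≡ eval G lb μ (v ∷ u ∷ []) []
open Transduction public

OutV : (τ : Transduction) (G : Graph) → (Fin (p τ) → Fin (n G) → Bool) → Set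
OutV τ G lb = Σ (Fin (n G)) λ v → eval G lb (ν τ) (v ∷ []) [] ≡ true

OutAdj : (τ : Transduction) (G : Graph) (lb : Fin (p τ) → Fin (n G) → Bool) →
         OutV τ G lb → OutV τ G lb → Bool
OutAdj τ G lb (u , _) (v , _) = not ⌊ u ≟ v ⌋ ∧ eval G lb (μ τ) (u ∷ v ∷ []) []

InTrans : {V : Set} → (V → V → Bool) → Transduction → Graph → Set
InTrans adjH τ G =
  Σ (Fin (p τ) → Fin (n G) → Bool) λ lb →
    (eval G lb (χ τ) [] [] ≡ true) × Iso adjH (OutAdj τ G lb)

-- Rooted trees in which every root-to-leaf path has length exactly d,
-- with leaf set Fin n.  'grow T n par _' adds a new level of n leaves,
-- the parent map being surjective (every old leaf becomes internal).

data LTree : ℕ → ℕ → Set where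
  root : LTree 0 1
  grow : ∀ {d k} → LTree d k → (n : ℕ) → (par : Fin n → Fin k) →
         (∀ y → ∃ λ x → par x ≡ y) → LTree (suc d) n

-- half of the distance in the tree between two leaves
halfDist : ∀ {d n} → LTree d n → Fin n → Fin n → ℕ
halfDist root u v = 0
halfDist (grow T n par _) u v =
  if ⌊ u ≟ v ⌋ then 0 else suc (halfDist T (par u) (par v))

record TreeModel (m d : ℕ) (G : Graph) : Set where
  field
    tree  : LTree d (n G)
    col   : Fin (n G) → Fin m
    S     : Fin m → Fin m → Fin d → Bool     -- (i,j,ℓ) ∈ S, with ℓ = toℕ + 1
    S-sym : ∀ i j ℓ → S i j ℓ ≡ S j i ℓ
    model : ∀ u v → ¬ (u ≡ v) → ∀ (ℓ : Fin d) →
            halfDist tree u v ≡ suc (toℕ ℓ) →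
            adj G u v ≡ S (col u) (col v) ℓ
open TreeModel public

-- Complete rooted r-ary tree of height d: nodes at depth k are
-- sequences in Fin r of length k; the children of s are x ∷ s.

-- Emb T r f : f (map from the depth-d nodes of T̄_d^r into the depth-d
-- nodes of T) is the deepest level of an injective, root- and
-- parent-preserving map T̄_d^r → T.
Emb : ∀ {d n} → LTree d n → (r : ℕ) → (Vec (Fin r) d → Fin n) → Set
Emb root r f = ⊤
Emb {suc d} (grow {k = k} T n par _) r f =
  (∀ s t → f s ≡ f t → s ≡ t) ×
  Σ (Vec (Fin r) d → Fin k) λ g → Emb T r g × (∀ x s → par (f (x ∷ s)) ≡ g s)

ContainsRooted : ∀ {d n} → LTree d n → ℕ → Set
ContainsRooted {d} {n} T r = Σ (Vec (Fin r) d → Fin n) λ f → Emb T r f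

TbarV : ℕ → ℕ → Set
TbarV d r = Σ (List (Fin r)) λ s → length s ≤ d

isChild : ∀ {r} → List (Fin r) → List (Fin r) → Bool
isChild s [] = false
isChild s (x ∷ t) = ⌊ ≡-dec _≟_ s t ⌋

TbarAdj : (d r : ℕ) → TbarV d r → TbarV d r → Bool
TbarAdj d r (s , _) (t , _) = isChild s t ∨ isChild t s

-- Idea.  σ guesses the colour classes of a tree-model M and "flip" labels
-- recording S.  From them MSO defines equivalence relations R_0 ⊇ … ⊇ R_d:
-- R_0 is total and R_{j+1} is connectivity, inside R_j-classes, along the
-- pairs whose adjacency differs from what S prescribes at half-distance
-- d ∸ j.  (1) R_j-related vertices are at half-distance ≤ d ∸ j in M, so
-- R_d is equality.  (2) The R_j-classes, ordered by inclusion, form a tree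
-- which with the colours and S of M is again a tree-model: the canonical
-- one.  By hypothesis it contains T̄_d^r, and then R_i relates two embedded
-- leaves iff they have the same ancestor at depth i.  (3) Padding each node
-- of T̄_d^{r-1} with the unused symbol r-1 picks one leaf per node; σ
-- outputs these leaves, labelled by depth, and joins depth k to depth k+1
-- when they are R_k-related — exactly the child relation of T̄_d^{r-1}.

module Submission where

open import Defs hiding (sym)

import Axiom.UniquenessOfIdentityProofs as UIP
open import Data.Bool using (Bool; true; false; not; _∧_; _∨_; _xor_; if_then_else_)
import Data.Bool as Bool
open import Data.Bool.ListAction as ListAction using (any)
open import Data.Bool.Properties using (T-≡; ¬-not; ∨-inverseˡ; ∨-comm; xor-same)
open import Data.Empty using (⊥-elim)
open import Data.Fin using (Fin; zero; suc; toℕ; _≟_; opposite; fromℕ; fromℕ<; inject₁;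
  join; splitAt; combine; remQuot)
open import Data.Fin.Properties using (any?; suc-injective; toℕ-injective; toℕ-inject₁; toℕ<n;
  toℕ-fromℕ<; opposite-prop; inject₁-injective; fromℕ≢inject₁; splitAt-join; remQuot-combine)
open import Data.List using (List; []; _∷_; allFin; concatMap; drop; map; replicate; length; _++_)
open import Data.List.Membership.Propositional using (_∈_; find)
open import Data.List.Membership.Propositional.Properties using (∈-allFin; ∈-concatMap⁺; ∈-map⁺)
open import Data.List.Properties using (≡-dec; map-cong; map-injective; length-++;
  length-replicate; length-map; ∷-injectiveˡ; ∷-injectiveʳ)
open import Data.List.Relation.Unary.Any as Any using (here; there)
open import Data.List.Relation.Unary.Any.Properties using (any⁺; any⁻)
open import Data.Nat using (ℕ; zero; suc; _+_; _*_; _≤_; _∸_; z≤n; s≤s; _≤?_)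
import Data.Nat.Properties as ℕₚ
open import Data.Nat.Properties using (≤-refl; ≤-antisym; ≤-irrelevant; ≰⇒>; <⇒≤; m≤n⇒m≤1+n;
  m≤n⇒m<n∨m≡n; n≤0⇒n≡0; n∸n≡0; +-identityʳ; +-suc; +-∸-assoc; m∸n+n≡m; 1+n≢n)
open import Data.Product using (Σ; ∃; _×_; _,_; proj₁; proj₂; uncurry)
open import Data.Sum using (inj₁; inj₂; [_,_])
open import Data.Vec using (Vec; []; _∷_; lookup; toList; fromList)
import Data.Vec as Vec
open import Data.Vec.Properties using (toList-injective; cast-is-id; toList∘fromList)
open import Function using (_∘_)
open import Function.Bundles using (Equivalence; _⇔_; mk⇔; mk↔ₛ′)
open import Relation.Binary.PropositionalEquality
  using (_≡_; refl; sym; trans; cong; cong₂; subst; subst₂; module ≡-Reasoning)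
open import Relation.Binary.Structures using (IsEquivalence)
open import Relation.Nullary using (¬_)
open import Relation.Nullary.Decidable using (Dec; ⌊_⌋; yes; no; toWitness; fromWitness)

any-intro : {A : Set} (f : A → Bool) {xs : List A} {x : A} →
            x ∈ xs → f x ≡ true → any f xs ≡ true
any-intro f x∈ fx = Equivalence.to T-≡
  (any⁺ f (Any.map (λ { refl → Equivalence.from T-≡ fx }) x∈))

any-elim : {A : Set} (f : A → Bool) {xs : List A} →
           any f xs ≡ true → ∃ λ x → x ∈ xs × f x ≡ true
any-elim f {xs} h with find (any⁻ f xs (Equivalence.from T-≡ h))
... | x , x∈ , fx = x , x∈ , Equivalence.to T-≡ fx

any-cong : {A : Set} {f g : A → Bool} → (∀ x → f x ≡ g x) →
           (xs : List A) → any f xs ≡ any g xs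
any-cong f≗g xs = cong ListAction.or (map-cong f≗g xs)

allL-intro : {A : Set} (f : A → Bool) (xs : List A) →
             (∀ x → f x ≡ true) → allL f xs ≡ true
allL-intro f xs all-true = cong not (¬-not no-counterexample)
  where
  no-counterexample : ¬ any (not ∘ f) xs ≡ true
  no-counterexample h with any-elim (not ∘ f) {xs} h
  ... | x , _ , nfx with () ← trans (cong not (sym (all-true x))) nfx

allL-elim : {A : Set} (f : A → Bool) {xs : List A} {x : A} →
            x ∈ xs → allL f xs ≡ true → f x ≡ true
allL-elim f {x = x} x∈ h with f x in fx
... | true = refl
... | false with any-intro (not ∘ f) x∈ (cong not fx)
...   | counterexample rewrite counterexample = h

allL-cong : {A : Set} {f g : A → Bool} → (∀ x → f x ≡ g x) →
            (xs : List A) → allL f xs ≡ allL g xs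
allL-cong f≗g xs = cong not (any-cong (cong not ∘ f≗g) xs)

allSubsets-complete : ∀ n (X : Fin n → Bool) →
  ∃ λ Y → Y ∈ allSubsets n × (∀ i → X i ≡ Y i)
allSubsets-complete zero X = (λ ()) , here refl , λ ()
allSubsets-complete (suc n) X with allSubsets-complete n (X ∘ suc)
... | Y , Y∈ , X≗Y with X zero in X0
...   | false = _ , ∈-concatMap⁺ _ (Any.map (λ { refl → here refl }) Y∈)
              , λ { zero → X0 ; (suc i) → X≗Y i }
...   | true  = _ , ∈-concatMap⁺ _ (Any.map (λ { refl → there (here refl) }) Y∈)
              , λ { zero → X0 ; (suc i) → X≗Y i }

⋁ : ∀ {q} → (Fin q → Bool) → Bool
⋁ {zero}  f = false
⋁ {suc q} f = f zero ∨ ⋁ (f ∘ suc)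

⋁-cong : ∀ {q} {f g : Fin q → Bool} → (∀ c → f c ≡ g c) → ⋁ f ≡ ⋁ g
⋁-cong {zero}  f≗g = refl
⋁-cong {suc q} f≗g = cong₂ _∨_ (f≗g zero) (⋁-cong (f≗g ∘ suc))

⋁-intro : ∀ {q} (f : Fin q → Bool) c → f c ≡ true → ⋁ f ≡ true
⋁-intro f zero fc rewrite fc = refl
⋁-intro f (suc c) fc with f zero
... | true  = refl
... | false = ⋁-intro (f ∘ suc) c fc

⋁-elim : ∀ {q} (f : Fin q → Bool) → ⋁ f ≡ true → ∃ λ c → f c ≡ true
⋁-elim {suc q} f h with f zero in f0
... | true  = zero , f0
... | false with ⋁-elim (f ∘ suc) h
...   | c , fc = suc c , fc

∧-intro : ∀ {x y} → x ≡ true → y ≡ true → x ∧ y ≡ true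
∧-intro refl refl = refl

∧-elim : ∀ x {y} → x ∧ y ≡ true → x ≡ true × y ≡ true
∧-elim true h = refl , h

⇒-intro : ∀ x y z → (x ≡ true → y ≡ true → z ≡ true) → not (x ∧ y) ∨ z ≡ true
⇒-intro true  true  z h = h refl refl
⇒-intro true  false z _ = refl
⇒-intro false y     z _ = refl

⇒-elim : ∀ x y z → not (x ∧ y) ∨ z ≡ true → x ≡ true → y ≡ true → z ≡ true
⇒-elim true true z h refl refl = h

xor-false : ∀ x y → x xor y ≡ false → x ≡ y
xor-false true  true  _ = refl
xor-false false false _ = refl

bool-ext : ∀ {a b} → (a ≡ true → b ≡ true) → (b ≡ true → a ≡ true) → a ≡ b
bool-ext {true}  {true}  _ _ = refl
bool-ext {true}  {false} f _ = sym (f refl)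
bool-ext {false} {true}  _ g = g refl
bool-ext {false} {false} _ _ = refl

-- Proofs of 'b ≡ true' are unique, so such a subset type has equality
-- determined by the underlying element.
Σ-true-≡ : {A : Set} {P : A → Bool} {a b : A} {p : P a ≡ true} {q : P b ≡ true} →
           a ≡ b → _≡_ {A = Σ A λ x → P x ≡ true} (a , p) (b , q)
Σ-true-≡ refl = cong (_ ,_) (UIP.Decidable⇒UIP.≡-irrelevant Bool._≟_ _ _)

dec-true : {P : Set} (x : Dec P) → ⌊ x ⌋ ≡ true → P
dec-true x h = toWitness (Equivalence.from T-≡ h)

true-dec : {P : Set} (x : Dec P) → P → ⌊ x ⌋ ≡ true
true-dec x p = Equivalence.to T-≡ (fromWitness p)

module _ {p : ℕ} where

  ⊤F : ∀ {k s} → Form p k s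
  ⊤F = all1 (eq zero zero)

  ⊥F : ∀ {k s} → Form p k s
  ⊥F = neg ⊤F

  ⋁F : ∀ {q k s} → (Fin q → Form p k s) → Form p k s
  ⋁F {zero}  φ = ⊥F
  ⋁F {suc q} φ = or (φ zero) (⋁F (φ ∘ suc))

  _⊕F_ : ∀ {k s} → Form p k s → Form p k s → Form p k s
  φ ⊕F ψ = or (and φ (neg ψ)) (and (neg φ) ψ)

  module _ (G : Graph) (lb : Fin p → Fin (n G) → Bool)
           {k s : ℕ} (ρ : Vec (Fin (n G)) k) (σ : Vec (Fin (n G) → Bool) s) where

    eval-⊤F : eval G lb ⊤F ρ σ ≡ true
    eval-⊤F = allL-intro _ (allFin (n G)) λ v → true-dec (v ≟ v) refl

    eval-⊥F : eval G lb ⊥F ρ σ ≡ false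
    eval-⊥F = cong not eval-⊤F

    eval-⋁F : ∀ {q} (φ : Fin q → Form p k s) →
              eval G lb (⋁F φ) ρ σ ≡ ⋁ (λ c → eval G lb (φ c) ρ σ)
    eval-⋁F {zero}  φ = eval-⊥F
    eval-⋁F {suc q} φ = cong (eval G lb (φ zero) ρ σ ∨_) (eval-⋁F (φ ∘ suc))

    eval-⊕F : (φ ψ : Form p k s) →
              eval G lb (φ ⊕F ψ) ρ σ ≡ eval G lb φ ρ σ xor eval G lb ψ ρ σ
    eval-⊕F φ ψ with eval G lb φ ρ σ | eval G lb ψ ρ σ
    ... | true  | true  = refl
    ... | true  | false = refl
    ... | false | true  = refl
    ... | false | false = refl

halfDist-self : ∀ {d k} (T : LTree d k) u → halfDist T u u ≡ 0
halfDist-self root u = refl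
halfDist-self (grow T _ par _) u with u ≟ u
... | yes _ = refl
... | no u≢u = ⊥-elim (u≢u refl)

halfDist-≤-depth : ∀ {d k} (T : LTree d k) u v → halfDist T u v ≤ d
halfDist-≤-depth root u v = z≤n
halfDist-≤-depth (grow T _ par _) u v with u ≟ v
... | yes _ = z≤n
... | no _  = s≤s (halfDist-≤-depth T (par u) (par v))

halfDist-zero : ∀ {d k} (T : LTree (suc d) k) u v → halfDist T u v ≡ 0 → u ≡ v
halfDist-zero (grow T _ par _) u v h with u ≟ v
halfDist-zero (grow T _ par _) u v h  | yes u≡v = u≡v
halfDist-zero (grow T _ par _) u v () | no _

halfDist-grow : ∀ {d k n} (T : LTree d k) (par : Fin n → Fin k) onto {u v} →
  ¬ u ≡ v → halfDist (grow T n par onto) u v ≡ suc (halfDist T (par u) (par v))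
halfDist-grow T par onto {u} {v} u≢v with u ≟ v
... | yes u≡v = ⊥-elim (u≢v u≡v)
... | no _    = refl

halfDist-ultra : ∀ {d k b} (T : LTree d k) u a w →
  halfDist T u a ≤ b → halfDist T a w ≤ b → halfDist T u w ≤ b
halfDist-ultra root u a w _ _ = z≤n
halfDist-ultra {b = b} T@(grow T' _ par onto) u a w ua aw = by-cases (u ≟ a) (a ≟ w)
  where
  by-cases : Dec (u ≡ a) → Dec (a ≡ w) → halfDist T u w ≤ b
  by-cases (yes u≡a) _ = subst (λ x → halfDist T x w ≤ b) (sym u≡a) aw
  by-cases _ (yes a≡w) = subst (λ x → halfDist T u x ≤ b) a≡w ua
  by-cases (no u≢a) (no a≢w) with u ≟ w
                                | subst (_≤ b) (halfDist-grow T' par onto u≢a) ua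
                                | subst (_≤ b) (halfDist-grow T' par onto a≢w) aw
  ... | yes _ | _       | _       = z≤n
  ... | no _  | s≤s ua' | s≤s aw' = s≤s (halfDist-ultra T' (par u) (par a) (par w) ua' aw')

-- They provide the nodes of the canonical tree-model.
Holds : ∀ {n} → (Fin n → Fin n → Bool) → Fin n → Fin n → Set
Holds R u v = R u v ≡ true

record Quotient (n : ℕ) (R : Fin n → Fin n → Bool) : Set where
  field
    k        : ℕ
    cls      : Fin n → Fin k
    rep      : Fin k → Fin n
    cls-rep  : ∀ c → cls (rep c) ≡ c
    sound    : ∀ u v → cls u ≡ cls v → R u v ≡ true
    complete : ∀ u v → R u v ≡ true → cls u ≡ cls v

restrict : ∀ {n} {R : Fin (suc n) → Fin (suc n) → Bool} → IsEquivalence (Holds R) →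
           IsEquivalence (Holds (λ u v → R (suc u) (suc v)))
restrict R-eqv = record { refl = refl′ ; sym = sym′ ; trans = trans′ }
  where open IsEquivalence R-eqv renaming (refl to refl′; sym to sym′; trans to trans′)

module _ {n : ℕ} {R : Fin (suc n) → Fin (suc n) → Bool}
         (R-eqv : IsEquivalence (Holds R))
         (Q : Quotient n (λ u v → R (suc u) (suc v))) where
  open IsEquivalence R-eqv renaming (refl to R-refl; sym to R-sym; trans to R-trans)
  open Quotient Q

  joinClass : ∀ v₀ → R zero (suc v₀) ≡ true → Quotient (suc n) R
  joinClass v₀ r₀ = record
    { k = k ; cls = cls′ ; rep = suc ∘ rep ; cls-rep = cls-rep
    ; sound = sound′ ; complete = complete′ }
    where
    cls′ : Fin (suc n) → Fin k
    cls′ zero    = cls v₀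
    cls′ (suc u) = cls u

    sound′ : ∀ u v → cls′ u ≡ cls′ v → R u v ≡ true
    sound′ zero    zero    _ = R-refl
    sound′ zero    (suc v) e = R-trans r₀ (sound v₀ v e)
    sound′ (suc u) zero    e = R-sym (R-trans r₀ (sound v₀ u (sym e)))
    sound′ (suc u) (suc v) e = sound u v e

    complete′ : ∀ u v → R u v ≡ true → cls′ u ≡ cls′ v
    complete′ zero    zero    _ = refl
    complete′ zero    (suc v) r = complete v₀ v (R-trans (R-sym r₀) r)
    complete′ (suc u) zero    r = sym (complete v₀ u (R-trans (R-sym r₀) (R-sym r)))
    complete′ (suc u) (suc v) r = complete u v r

  newClass : (∀ v → ¬ R zero (suc v) ≡ true) → Quotient (suc n) R
  newClass isolated = record
    { k = suc k ; cls = cls′ ; rep = rep′ ; cls-rep = cls-rep′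
    ; sound = sound′ ; complete = complete′ }
    where
    cls′ : Fin (suc n) → Fin (suc k)
    cls′ zero    = zero
    cls′ (suc u) = suc (cls u)

    rep′ : Fin (suc k) → Fin (suc n)
    rep′ zero    = zero
    rep′ (suc c) = suc (rep c)

    cls-rep′ : ∀ c → cls′ (rep′ c) ≡ c
    cls-rep′ zero    = refl
    cls-rep′ (suc c) = cong suc (cls-rep c)

    sound′ : ∀ u v → cls′ u ≡ cls′ v → R u v ≡ true
    sound′ zero    zero    _ = R-refl
    sound′ (suc u) (suc v) e = sound u v (suc-injective e)

    complete′ : ∀ u v → R u v ≡ true → cls′ u ≡ cls′ v
    complete′ zero    zero    _ = refl
    complete′ zero    (suc v) r = ⊥-elim (isolated v r)
    complete′ (suc u) zero    r = ⊥-elim (isolated u (R-sym r))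
    complete′ (suc u) (suc v) r = cong suc (complete u v r)

quotient : ∀ n (R : Fin n → Fin n → Bool) → IsEquivalence (Holds R) → Quotient n R
quotient zero R _ = record
  { k = 0 ; cls = λ () ; rep = λ () ; cls-rep = λ () ; sound = λ () ; complete = λ () }
quotient (suc n) R R-eqv with any? (λ v → R zero (suc v) Bool.≟ true)
... | yes (v₀ , r₀) = joinClass R-eqv (quotient n _ (restrict R-eqv)) v₀ r₀
... | no none       = newClass R-eqv (quotient n _ (restrict R-eqv)) (λ v r → none (v , r))

-- The labels guessed by the transduction, for trees of depth d and m colours:
--   level k  (k ≤ d)  marks the vertex representing a node of depth k of T̄;
--   colour c          marks the vertices of colour c of a tree-model;
--   flip ℓ c          marks the vertices v with (col v, c, ℓ+1) ∈ S.
module Labels (d m : ℕ) where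

  data Label : Set where
    level  : Fin (suc d) → Label
    colour : Fin m → Label
    flip   : Fin d → Fin m → Label

  #labels : ℕ
  #labels = suc d + (m + d * m)

  encode : Label → Fin #labels
  encode (level k)  = join (suc d) _ (inj₁ k)
  encode (colour c) = join (suc d) _ (inj₂ (join m _ (inj₁ c)))
  encode (flip ℓ c) = join (suc d) _ (inj₂ (join m _ (inj₂ (combine ℓ c))))

  decode : Fin #labels → Label
  decode = [ level , [ colour , uncurry flip ∘ remQuot m ] ∘ splitAt m ] ∘ splitAt (suc d)

  decode-encode : ∀ x → decode (encode x) ≡ x
  decode-encode (level k)  rewrite splitAt-join (suc d) (m + d * m) (inj₁ k) = refl
  decode-encode (colour c)
    rewrite splitAt-join (suc d) (m + d * m) (inj₂ (join m (d * m) (inj₁ c)))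
          | splitAt-join m (d * m) (inj₁ c) = refl
  decode-encode (flip ℓ c)
    rewrite splitAt-join (suc d) (m + d * m) (inj₂ (join m (d * m) (inj₂ (combine ℓ c))))
          | splitAt-join m (d * m) (inj₂ (combine ℓ c)) = cong (uncurry flip) (remQuot-combine ℓ c)

∸-suc : ∀ {d t} → suc t ≤ d → d ∸ t ≡ suc (d ∸ suc t)
∸-suc (s≤s t≤d) = +-∸-assoc 1 t≤d

clamp : ∀ {e} → ℕ → Fin (suc e)
clamp zero                = zero
clamp {zero}  (suc j)     = zero
clamp {suc e} (suc j)     = suc (clamp j)

toℕ-clamp : ∀ {e} j → j ≤ e → toℕ (clamp {e} j) ≡ j
toℕ-clamp         zero    _       = refl
toℕ-clamp {suc e} (suc j) (s≤s p) = cong suc (toℕ-clamp j p)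

-- Given colour labels and flip labels, 'expected j a b' is the adjacency a
-- tree-model would prescribe for a, b at half-distance d ∸ j, i.e. at
-- level 'levelAt j', and H_j ('Disagree j') joins the pairs whose actual
-- adjacency differs from it.
module Definable (e m : ℕ) where
  d : ℕ
  d = suc e
  open Labels d m public

  levelAt : ℕ → Fin d
  levelAt j = opposite (clamp j)

  toℕ-levelAt : ∀ j → j ≤ e → toℕ (levelAt j) ≡ e ∸ j
  toℕ-levelAt j j≤e = trans (opposite-prop (clamp j)) (cong (e ∸_) (toℕ-clamp j j≤e))

  lbl : ∀ {k s} → Label → Fin k → Form #labels k s
  lbl x = lab (encode x)

  expectedF : ∀ {k s} → ℕ → Fin k → Fin k → Form #labels k s
  expectedF j a b = ⋁F (λ c → and (lbl (colour c) b) (lbl (flip (levelAt j) c) a))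

  disagreeF : ∀ {k s} → ℕ → Fin k → Fin k → Form #labels k s
  disagreeF j a b = edge a b ⊕F expectedF j a b

  relF : ∀ {k s} → ℕ → Fin k → Fin k → Form #labels k s
  relF zero    a b = ⊤F
  relF {k} {s} (suc j) a b = allS (or (neg (and (mem a zero) closedF)) (mem b zero))
    where
    -- the set variable 0 is closed under H_j-edges inside R_j-classes
    closedF : Form #labels k (suc s)
    closedF = all1 (all1 (or (neg (and (mem (suc zero) zero)
                                  (and (relF j (suc zero) zero) (disagreeF j (suc zero) zero))))
                             (mem zero zero)))

  module Semantics (G : Graph) (colourL : Fin m → Fin (n G) → Bool)
                   (flipL : Fin d → Fin m → Fin (n G) → Bool) where
    V : Set
    V = Fin (n G)

    expected : ℕ → V → V → Bool
    expected j a b = ⋁ (λ c → colourL c b ∧ flipL (levelAt j) c a)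

    Disagree : ℕ → V → V → Bool
    Disagree j a b = adj G a b xor expected j a b

    Rel : ℕ → V → V → Bool
    Closed : ℕ → (V → Bool) → Bool
    Rel zero    u v = true
    Rel (suc j) u v = allL (λ X → not (X u ∧ Closed j X) ∨ X v) (allSubsets (n G))
    Closed j X = allL (λ a → allL (λ b → not (X a ∧ (Rel j a b ∧ Disagree j a b)) ∨ X b)
                                  (allFin (n G))) (allFin (n G))

    module _ (lb : Fin #labels → V → Bool)
             (lb-colour : ∀ c v → lb (encode (colour c)) v ≡ colourL c v)
             (lb-flip : ∀ ℓ c v → lb (encode (flip ℓ c)) v ≡ flipL ℓ c v) where

      eval-expectedF : ∀ {k s} j (a b : Fin k) (ρ : Vec V k) (σ : Vec (V → Bool) s) →
        eval G lb (expectedF j a b) ρ σ ≡ expected j (lookup ρ a) (lookup ρ b)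
      eval-expectedF j a b ρ σ =
        trans (eval-⋁F G lb ρ σ (λ c → and (lbl (colour c) b) (lbl (flip (levelAt j) c) a)))
              (⋁-cong λ c → cong₂ _∧_ (lb-colour c _) (lb-flip (levelAt j) c _))

      eval-disagreeF : ∀ {k s} j (a b : Fin k) (ρ : Vec V k) (σ : Vec (V → Bool) s) →
        eval G lb (disagreeF j a b) ρ σ ≡ Disagree j (lookup ρ a) (lookup ρ b)
      eval-disagreeF j a b ρ σ =
        trans (eval-⊕F G lb ρ σ (edge a b) (expectedF j a b))
              (cong (adj G (lookup ρ a) (lookup ρ b) xor_) (eval-expectedF j a b ρ σ))

      eval-relF : ∀ {k s} j (a b : Fin k) (ρ : Vec V k) (σ : Vec (V → Bool) s) →
        eval G lb (relF j a b) ρ σ ≡ Rel j (lookup ρ a) (lookup ρ b)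
      eval-relF zero    a b ρ σ = eval-⊤F G lb ρ σ
      eval-relF (suc j) a b ρ σ = allL-cong (λ X →
        cong (λ z → not (X (lookup ρ a) ∧ z) ∨ X (lookup ρ b))
          (allL-cong (λ x → allL-cong (λ y →
             cong (λ z → not (X x ∧ z) ∨ X y)
               (cong₂ _∧_ (eval-relF j (suc zero) zero (y ∷ x ∷ ρ) (X ∷ σ))
                          (eval-disagreeF j (suc zero) zero (y ∷ x ∷ ρ) (X ∷ σ))))
             (allFin (n G))) (allFin (n G))))
        (allSubsets (n G))

    IsClosed : ℕ → (V → Bool) → Set
    IsClosed j X =
      ∀ a b → X a ≡ true → Rel j a b ≡ true → Disagree j a b ≡ true → X b ≡ true

    Reach : ℕ → V → V → Set
    Reach j u v = ∀ X → X u ≡ true → IsClosed j X → X v ≡ true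

    Closed-intro : ∀ j X → IsClosed j X → Closed j X ≡ true
    Closed-intro j X closed =
      allL-intro _ (allFin (n G)) λ a → allL-intro _ (allFin (n G)) λ b →
      ⇒-intro (X a) _ (X b) λ Xa r∧h → uncurry (closed a b Xa) (∧-elim _ r∧h)

    Closed-elim : ∀ j X → Closed j X ≡ true → IsClosed j X
    Closed-elim j X closed a b Xa r h =
      ⇒-elim (X a) _ (X b)
        (allL-elim _ (∈-allFin b) (allL-elim _ (∈-allFin a) closed)) Xa (∧-intro r h)

    Rel-suc-intro : ∀ j u v → Reach j u v → Rel (suc j) u v ≡ true
    Rel-suc-intro j u v reach = allL-intro _ (allSubsets (n G)) λ X →
      ⇒-intro (X u) (Closed j X) (X v) λ Xu closed → reach X Xu (Closed-elim j X closed)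

    -- An arbitrary set X is replaced by its pointwise-equal copy from the
    -- enumeration 'allSubsets'.
    Rel-suc-elim : ∀ j u v → Rel (suc j) u v ≡ true → Reach j u v
    Rel-suc-elim j u v r X Xu closed with allSubsets-complete (n G) X
    ... | Y , Y∈ , X≗Y = trans (X≗Y v) (⇒-elim (Y u) (Closed j Y) (Y v)
          (allL-elim _ Y∈ r) (trans (sym (X≗Y u)) Xu)
          (Closed-intro j Y λ a b Ya rab hab →
             trans (sym (X≗Y b)) (closed a b (trans (X≗Y a) Ya) rab hab)))

  module InModel (G : Graph) (M : TreeModel m d G) where
    colourOf : Fin m → Fin (n G) → Bool
    colourOf c v = ⌊ col M v ≟ c ⌋

    flipOf : Fin d → Fin m → Fin (n G) → Bool
    flipOf ℓ c v = S M (col M v) c ℓ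

    open Semantics G colourOf flipOf public

    -- The colour labels single out col b, so 'expected' is an entry of S.
    expected-S : ∀ j a b → expected j a b ≡ S M (col M a) (col M b) (levelAt j)
    expected-S j a b = bool-ext from-⋁ to-⋁
      where
      from-⋁ : expected j a b ≡ true → S M (col M a) (col M b) (levelAt j) ≡ true
      from-⋁ h with ⋁-elim _ h
      ... | c , hc with ∧-elim (colourOf c b) hc
      ...   | is-c , s = subst (λ c′ → S M (col M a) c′ (levelAt j) ≡ true)
                               (sym (dec-true (col M b ≟ c) is-c)) s
      to-⋁ : S M (col M a) (col M b) (levelAt j) ≡ true → expected j a b ≡ true
      to-⋁ s = ⋁-intro _ (col M b) (∧-intro (true-dec (col M b ≟ col M b) refl) s)

    Disagree-sym : ∀ j a b → Disagree j a b ≡ Disagree j b a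
    Disagree-sym j a b
      rewrite expected-S j a b | expected-S j b a | Graph.sym G a b
            | S-sym M (col M a) (col M b) (levelAt j) = refl

    Rel-step : ∀ j a b → Rel j a b ≡ true → Disagree j a b ≡ true → Rel (suc j) a b ≡ true
    Rel-step j a b r h = Rel-suc-intro j a b λ X Xa closed → closed a b Xa r h

    -- Each R_j is an equivalence relation.  For symmetry, the set of w with
    -- X w ⇒ X u is closed whenever X is, because H_j and R_j are symmetric.
    Rel-isEquivalence : ∀ j → IsEquivalence (Holds (Rel j))
    Rel-isEquivalence zero = record { refl = refl ; sym = λ _ → refl ; trans = λ _ _ → refl }
    Rel-isEquivalence (suc j) = record
      { refl = λ {u} → Rel-suc-intro j u u λ _ Xu _ → Xu ; sym = sym′ ; trans = trans′ }
      where
      open IsEquivalence (Rel-isEquivalence j) using () renaming (sym to Rj-sym)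

      trans′ : ∀ {u v w} → Rel (suc j) u v ≡ true → Rel (suc j) v w ≡ true →
               Rel (suc j) u w ≡ true
      trans′ {u} {v} {w} p q = Rel-suc-intro j u w λ X Xu closed →
        Rel-suc-elim j v w q X (Rel-suc-elim j u v p X Xu closed) closed

      implies-closed : ∀ X u → IsClosed j X → IsClosed j (λ w → not (X w) ∨ X u)
      implies-closed X u closed a b Za rab hab with X b in Xb
      ... | false = refl
      ... | true  = subst (λ x → not x ∨ X u ≡ true)
                          (closed b a Xb (Rj-sym rab) (trans (Disagree-sym j b a) hab)) Za

      sym′ : ∀ {u v} → Rel (suc j) u v ≡ true → Rel (suc j) v u ≡ true
      sym′ {u} {v} p = Rel-suc-intro j v u λ X Xv closed →
        subst (λ x → not x ∨ X u ≡ true) Xv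
          (Rel-suc-elim j u v p (λ w → not (X w) ∨ X u) (∨-inverseˡ (X u))
                        (implies-closed X u closed))

    -- The relations decrease: R_j-classes are closed sets for R_{j+1}.
    Rel-antitone : ∀ j u v → Rel (suc j) u v ≡ true → Rel j u v ≡ true
    Rel-antitone j u v r = Rel-suc-elim j u v r (Rel j u) refl′ λ a b ua ab _ → trans′ ua ab
      where
      open IsEquivalence (Rel-isEquivalence j) using () renaming (refl to refl′; trans to trans′)

    -- Inside an R_j-class, a pair at half-distance exactly d ∸ j is
    -- adjacent as S prescribes at level 'levelAt j', so it is no H_j-edge;
    -- hence H_j-edges never leave the ball of radius e ∸ j around u.
    Rel-bounds-halfDist : ∀ j → j ≤ d → ∀ a b → Rel j a b ≡ true →
                          halfDist (tree M) a b ≤ d ∸ j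
    Rel-bounds-halfDist zero    _         a b _ = halfDist-≤-depth (tree M) a b
    Rel-bounds-halfDist (suc j) (s≤s j≤e) u v r =
      dec-true (halfDist T u v ≤? e ∸ j) (Rel-suc-elim j u v r ball ball-u ball-closed)
      where
      T : LTree d (n G)
      T = tree M

      ball : V → Bool
      ball w = ⌊ halfDist T u w ≤? e ∸ j ⌋

      ball-u : ball u ≡ true
      ball-u = true-dec (halfDist T u u ≤? e ∸ j)
                        (subst (_≤ e ∸ j) (sym (halfDist-self T u)) z≤n)

      no-disagreement : ∀ a b → Rel j a b ≡ true → ¬ halfDist T a b ≤ e ∸ j →
                        Disagree j a b ≡ false
      no-disagreement a b rab far = begin
        adj G a b xor expected j a b ≡⟨ cong (adj G a b xor_) (expected-S j a b) ⟩
        adj G a b xor prescribed     ≡⟨ cong (_xor prescribed) adj-prescribed ⟩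
        prescribed xor prescribed    ≡⟨ xor-same prescribed ⟩
        false                        ∎
        where
        open ≡-Reasoning
        ℓ : Fin d
        ℓ = levelAt j
        prescribed : Bool
        prescribed = S M (col M a) (col M b) ℓ
        exact : halfDist T a b ≡ suc (toℕ ℓ)
        exact = trans (≤-antisym (subst (halfDist T a b ≤_) (+-∸-assoc 1 j≤e)
                                        (Rel-bounds-halfDist j (m≤n⇒m≤1+n j≤e) a b rab))
                                 (≰⇒> far))
                      (cong suc (sym (toℕ-levelAt j j≤e)))
        a≢b : ¬ a ≡ b
        a≢b refl = far (subst (_≤ e ∸ j) (sym (halfDist-self T a)) z≤n)
        adj-prescribed : adj G a b ≡ prescribed
        adj-prescribed = model M a b a≢b ℓ exact

      ball-closed : IsClosed j ball
      ball-closed a b Ba rab hab with halfDist T a b ≤? e ∸ j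
      ... | yes near = true-dec (halfDist T u b ≤? e ∸ j)
                         (halfDist-ultra T u a b (dec-true (halfDist T u a ≤? e ∸ j) Ba) near)
      ... | no far with () ← trans (sym hab) (no-disagreement a b rab far)

    Rel-top-discrete : ∀ u v → Rel d u v ≡ true → u ≡ v
    Rel-top-discrete u v r = halfDist-zero (tree M) u v (n≤0⇒n≡0
      (subst (halfDist (tree M) u v ≤_) (n∸n≡0 d) (Rel-bounds-halfDist d ≤-refl u v r)))

    -- Where R_i still relates a and b but R_{i+1} no longer does, they
    -- are not H_i-adjacent, so their adjacency is the one S prescribes at
    -- level 'levelAt i'.
    adj-at-separation : ∀ i a b → Rel i a b ≡ true → Rel (suc i) a b ≡ false →
                        adj G a b ≡ S M (col M a) (col M b) (levelAt i)
    adj-at-separation i a b r r′ with Disagree i a b in h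
    ... | true  with () ← trans (sym (Rel-step i a b r h)) r′
    ... | false = trans (xor-false _ _ h) (expected-S i a b)

toList-inj : {A : Set} {k : ℕ} (s t : Vec A k) → toList s ≡ toList t → s ≡ t
toList-inj s t same = trans (sym (cast-is-id refl s)) (toList-injective refl s t same)

-- Layer j of its tree consists of the R_j-classes,
-- the parent of an R_{j+1}-class being the R_j-class containing it; the
-- leaves are the vertices themselves.  With the colours and S of M this is
-- again a tree-model of G, and it is determined by the labelling alone.
module Canonical (e m : ℕ) (G : Graph) (M : TreeModel m (suc e) G) (u₀ : Fin (n G)) where
  open Definable e m
  open InModel G M public

  -- half-distance of the R_j-classes of a and b in the canonical tree
  relDist : ℕ → V → V → ℕ
  relDist zero    a b = 0
  relDist (suc j) a b = if Rel (suc j) a b then 0 else suc (relDist j a b)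

  record Layer (j : ℕ) : Set where
    field
      k            : ℕ
      tr           : LTree j k
      anc          : V → Fin k
      anc-onto     : ∀ c → ∃ λ a → anc a ≡ c
      anc-sound    : ∀ a b → anc a ≡ anc b → Rel j a b ≡ true
      anc-complete : ∀ a b → Rel j a b ≡ true → anc a ≡ anc b
      halfDist-anc : ∀ a b → halfDist tr (anc a) (anc b) ≡ relDist j a b

  rootLayer : Layer 0
  rootLayer = record
    { k = 1 ; tr = root ; anc = λ _ → zero ; anc-onto = λ { zero → u₀ , refl }
    ; anc-sound = λ _ _ _ → refl ; anc-complete = λ _ _ _ → refl ; halfDist-anc = λ _ _ → refl }

  module Next {j : ℕ} (L : Layer j) where
    open Layer L using (anc; anc-onto; anc-complete) renaming (tr to trL; halfDist-anc to halfDist-ancL)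
    Q : Quotient (n G) (Rel (suc j))
    Q = quotient (n G) (Rel (suc j)) (Rel-isEquivalence (suc j))
    open Quotient Q using (cls; rep; cls-rep; sound; complete)

    par : Fin (Quotient.k Q) → Fin (Layer.k L)
    par = anc ∘ rep

    par-cls : ∀ a → par (cls a) ≡ anc a
    par-cls a = anc-complete _ _ (Rel-antitone j _ _ (sound _ _ (cls-rep (cls a))))

    par-onto : ∀ y → ∃ λ x → par x ≡ y
    par-onto y with anc-onto y
    ... | a , refl = cls a , par-cls a

    tr′ : LTree (suc j) (Quotient.k Q)
    tr′ = grow trL (Quotient.k Q) par par-onto

    halfDist-cls : ∀ a b → halfDist tr′ (cls a) (cls b) ≡ relDist (suc j) a b
    halfDist-cls a b with cls a ≟ cls b | Rel (suc j) a b in r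
    ... | yes same | true  = refl
    ... | yes same | false with () ← trans (sym (sound a b same)) r
    ... | no diff  | true  = ⊥-elim (diff (complete a b r))
    ... | no diff  | false = trans (cong₂ (λ x y → suc (halfDist trL x y)) (par-cls a) (par-cls b))
                                   (cong suc (halfDist-ancL a b))

    layer′ : Layer (suc j)
    layer′ = record
      { k = Quotient.k Q ; tr = tr′ ; anc = cls ; anc-onto = λ c → rep c , cls-rep c
      ; anc-sound = sound ; anc-complete = complete ; halfDist-anc = halfDist-cls }

  layer : ∀ j → Layer j
  layer zero    = rootLayer
  layer (suc j) = Next.layer′ (layer j)

  treeAt : (j : ℕ) → LTree j (Layer.k (layer j))
  treeAt j = Layer.tr (layer j)

  anc : (j : ℕ) → V → Fin (Layer.k (layer j))
  anc j = Layer.anc (layer j)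

  leaves : LTree d (n G)
  leaves = grow (treeAt e) (n G) (anc e) (Layer.anc-onto (layer e))

  adj-at-level : ∀ i → i ≤ e → ∀ a b (ℓ : Fin d) →
                 Rel i a b ≡ true → Rel (suc i) a b ≡ false → toℕ ℓ ≡ e ∸ i → adj G a b ≡ S M (col M a) (col M b) ℓ
  adj-at-level i i≤e a b ℓ r sep ℓ≡ = trans (adj-at-separation i a b r sep)
    (cong (S M (col M a) (col M b)) (toℕ-injective (trans (toℕ-levelAt i i≤e) (sym ℓ≡))))

  adj-canonical : ∀ j → j ≤ e → ∀ a b (ℓ : Fin d) → Rel (suc j) a b ≡ false →
                  toℕ ℓ ≡ (e ∸ j) + relDist j a b → adj G a b ≡ S M (col M a) (col M b) ℓ
  adj-canonical zero z≤n a b ℓ sep ℓ≡ =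
    adj-at-level zero z≤n a b ℓ refl sep (trans ℓ≡ (+-identityʳ e))
  adj-canonical (suc j) j<e a b ℓ sep ℓ≡ with Rel (suc j) a b in r
  ... | true  = adj-at-level (suc j) j<e a b ℓ r sep (trans ℓ≡ (+-identityʳ (e ∸ suc j)))
  ... | false = adj-canonical j (<⇒≤ j<e) a b ℓ r
                  (trans ℓ≡ (trans (+-suc (e ∸ suc j) (relDist j a b))
                                   (cong (_+ relDist j a b) (sym (∸-suc j<e)))))

  canonicalModel : TreeModel m d G
  canonicalModel = record
    { tree = leaves ; col = col M ; S = S M ; S-sym = S-sym M ; model = model′ }
    where
    model′ : ∀ u v → ¬ u ≡ v → ∀ (ℓ : Fin d) → halfDist leaves u v ≡ suc (toℕ ℓ) →
             adj G u v ≡ S M (col M u) (col M v) ℓ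
    model′ u v u≢v ℓ h = adj-canonical e ≤-refl u v ℓ separated
      (trans (ℕₚ.suc-injective (trans (sym h) distance))
             (cong (_+ relDist e u v) (sym (n∸n≡0 e))))
      where
      separated : Rel d u v ≡ false
      separated with Rel d u v in r
      ... | true  = ⊥-elim (u≢v (Rel-top-discrete u v r))
      ... | false = refl
      distance : halfDist leaves u v ≡ suc (relDist e u v)
      distance = trans (halfDist-grow (treeAt e) (anc e) (Layer.anc-onto (layer e)) u≢v)
                       (cong suc (Layer.halfDist-anc (layer e) u v))

  embedded-Rel : ∀ {r} j (g : Vec (Fin r) j → Fin (Layer.k (layer j))) → Emb (treeAt j) r g →
    ∀ a b s t → anc j a ≡ g s → anc j b ≡ g t → ∀ i → i ≤ j →
    Rel i a b ≡ true ⇔ drop (j ∸ i) (toList s) ≡ drop (j ∸ i) (toList t)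
  embedded-Rel zero g _ a b [] [] _ _ zero z≤n = mk⇔ (λ _ → refl) (λ _ → refl)
  embedded-Rel (suc j) g (g-inj , g′ , emb′ , link) a b s t a↦ b↦ i i≤ with m≤n⇒m<n∨m≡n i≤
  ... | inj₂ refl rewrite n∸n≡0 j = mk⇔
    (λ r → cong toList (g-inj s t (trans (sym a↦) (trans (Layer.anc-complete L a b r) b↦))))
    (λ same → Layer.anc-sound L a b (trans a↦ (trans (cong g (toList-inj s t same)) (sym b↦))))
    where L = layer (suc j)
  embedded-Rel (suc j) g (g-inj , g′ , emb′ , link) a b (x ∷ s) (y ∷ t) a↦ b↦ i i≤
    | inj₁ (s≤s i≤j) rewrite +-∸-assoc 1 i≤j =
    embedded-Rel j g′ emb′ a b s t (parent a x s a↦) (parent b y t b↦) i i≤j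
    where
    parent : ∀ c z w → anc (suc j) c ≡ g (z ∷ w) → anc j c ≡ g′ w
    parent c z w c↦ = trans (sym (Next.par-cls (layer j) c))
                            (trans (cong (Next.par (layer j)) c↦) (link z w))

  embedded-leaves : ∀ {r} (F : Vec (Fin r) d → Fin (n G)) → Emb leaves r F →
    ∀ i → i ≤ e → ∀ w w′ →
    Rel i (F w) (F w′) ≡ true ⇔ drop (d ∸ i) (toList w) ≡ drop (d ∸ i) (toList w′)
  embedded-leaves F (_ , g , emb , link) i i≤e (x ∷ s) (y ∷ t) rewrite +-∸-assoc 1 i≤e =
    embedded-Rel e g emb (F (x ∷ s)) (F (y ∷ t)) s t (link x s) (link y t) i i≤e

nodes : ∀ d r → List (TbarV d r)
nodes zero    r = ([] , z≤n) ∷ []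
nodes (suc d) r = ([] , z≤n) ∷ concatMap children (nodes d r)
  where
  children : TbarV d r → List (TbarV (suc d) r)
  children (s , |s|≤d) = map (λ z → z ∷ s , s≤s |s|≤d) (allFin r)

nodes-complete : ∀ d r (x : TbarV d r) → x ∈ nodes d r
nodes-complete zero    r ([] , z≤n)       = here refl
nodes-complete (suc d) r ([] , z≤n)       = here refl
nodes-complete (suc d) r (z ∷ s , s≤s |s|≤d) =
  there (∈-concatMap⁺ _ (Any.map (λ { refl → ∈-map⁺ _ (∈-allFin z) })
                                 (nodes-complete d r (s , |s|≤d))))

-- Padding is injective, and the ancestor at depth |s| of the
-- padded leaf is s itself, which recovers the child relation.
module Padding (d r : ℕ) where

  fresh : Fin (suc r)
  fresh = fromℕ r

  pad : List (Fin r) → List (Fin (suc r))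
  pad s = replicate (d ∸ length s) fresh ++ map inject₁ s

  length-pad : ∀ s → length s ≤ d → length (pad s) ≡ d
  length-pad s |s|≤d = begin
    length (replicate (d ∸ length s) fresh ++ map inject₁ s)
      ≡⟨ length-++ (replicate (d ∸ length s) fresh) ⟩
    length (replicate (d ∸ length s) fresh) + length (map inject₁ s)
      ≡⟨ cong₂ _+_ (length-replicate (d ∸ length s)) (length-map inject₁ s) ⟩
    (d ∸ length s) + length s
      ≡⟨ m∸n+n≡m |s|≤d ⟩
    d ∎
    where open ≡-Reasoning

  padVec : TbarV d r → Vec (Fin (suc r)) d
  padVec (s , |s|≤d) = subst (Vec (Fin (suc r))) (length-pad s |s|≤d) (fromList (pad s))

  toList-padVec : ∀ x → toList (padVec x) ≡ pad (proj₁ x)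
  toList-padVec (s , |s|≤d) = lemma (pad s) (length-pad s |s|≤d)
    where
    lemma : ∀ l (p : length l ≡ d) → toList (subst (Vec (Fin (suc r))) p (fromList l)) ≡ l
    lemma l refl = toList∘fromList l

  -- the fresh symbol never occurs in map inject₁ s, so padding can be undone
  pad-injective : ∀ a b s t →
    replicate a fresh ++ map inject₁ s ≡ replicate b fresh ++ map inject₁ t → s ≡ t
  pad-injective zero    zero    s       t       same = map-injective inject₁-injective same
  pad-injective (suc a) (suc b) s       t       same = pad-injective a b s t (∷-injectiveʳ same)
  pad-injective zero    (suc b) (x ∷ s) t       same =
    ⊥-elim (fromℕ≢inject₁ (sym (∷-injectiveˡ same)))
  pad-injective (suc a) zero    s       (y ∷ t) same =
    ⊥-elim (fromℕ≢inject₁ (∷-injectiveˡ same))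

  padVec-injective : ∀ x y → padVec x ≡ padVec y → x ≡ y
  padVec-injective (s , p) (t , q) same
    with pad-injective _ _ s t (trans (sym (toList-padVec (s , p)))
                                      (trans (cong toList same) (toList-padVec (t , q))))
  ... | refl = cong (s ,_) (≤-irrelevant p q)

  drop-replicate : ∀ k l → drop k (replicate k fresh ++ l) ≡ l
  drop-replicate zero    l = refl
  drop-replicate (suc k) l = drop-replicate k l

  drop-replicate-suc : ∀ k x l → drop (suc k) (replicate k fresh ++ x ∷ l) ≡ l
  drop-replicate-suc zero    x l = refl
  drop-replicate-suc (suc k) x l = drop-replicate-suc k x l

  drop-pad : ∀ s → drop (d ∸ length s) (pad s) ≡ map inject₁ s
  drop-pad s = drop-replicate (d ∸ length s) (map inject₁ s)

  drop-pad-child : ∀ z s → suc (length s) ≤ d →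
                   drop (d ∸ length s) (pad (z ∷ s)) ≡ map inject₁ s
  drop-pad-child z s |zs|≤d rewrite ∸-suc |zs|≤d =
    drop-replicate-suc (d ∸ suc (length s)) (inject₁ z) (map inject₁ s)

  child-iff-ancestor : ∀ s t → length t ≡ suc (length s) → length t ≤ d →
    isChild s t ≡ true ⇔ drop (d ∸ length s) (pad s) ≡ drop (d ∸ length s) (pad t)
  child-iff-ancestor s (z ∷ t) |t|≡|s| |zt|≤d = mk⇔
    (λ child → trans (drop-pad s) (trans (cong (map inject₁) (dec-true (≡-dec _≟_ s t) child))
                                         (sym drop-parent)))
    (λ same → true-dec (≡-dec _≟_ s t)
                (map-injective inject₁-injective (trans (sym (drop-pad s)) (trans same drop-parent))))
    where
    drop-parent : drop (d ∸ length s) (pad (z ∷ t)) ≡ map inject₁ t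
    drop-parent = subst (λ k → drop (d ∸ k) (pad (z ∷ t)) ≡ map inject₁ t)
                        (ℕₚ.suc-injective |t|≡|s|) (drop-pad-child z t |zt|≤d)

  child-length : ∀ (s t : List (Fin r)) → isChild s t ≡ true → length t ≡ suc (length s)
  child-length s (z ∷ t) child = cong (suc ∘ length) (sym (dec-true (≡-dec _≟_ s t) child))

  not-own-child : ∀ (s : List (Fin r)) → isChild s s ≡ false
  not-own-child []      = refl
  not-own-child (x ∷ s) = ¬-not λ child → 1+n≢n (sym (child-length (x ∷ s) (x ∷ s) child))

module Construction (e m : ℕ) where
  open Definable e m

  childAtF : Fin 2 → Fin 2 → Fin d → Form #labels 2 0
  childAtF x y k = and (lbl (level (inject₁ k)) x) (and (lbl (level (suc k)) y) (relF (toℕ k) x y))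

  childF : Fin 2 → Fin 2 → Form #labels 2 0
  childF x y = ⋁F (childAtF x y)

  νF : Form #labels 1 0
  νF = ⋁F (λ k → lbl (level k) zero)

  μF : Form #labels 2 0
  μF = or (childF zero (suc zero)) (childF (suc zero) zero)

  module Output (G : Graph) (colourL : Fin m → Fin (n G) → Bool)
                (flipL : Fin d → Fin m → Fin (n G) → Bool)
                (lb : Fin #labels → Fin (n G) → Bool)
                (lb-colour : ∀ c v → lb (encode (colour c)) v ≡ colourL c v)
                (lb-flip : ∀ ℓ c v → lb (encode (flip ℓ c)) v ≡ flipL ℓ c v) where
    open Semantics G colourL flipL

    hasLevel : Fin (suc d) → V → Bool
    hasLevel k = lb (encode (level k))

    childAt : V → V → Fin d → Bool
    childAt u v k = hasLevel (inject₁ k) u ∧ (hasLevel (suc k) v ∧ Rel (toℕ k) u v)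

    Child : V → V → Bool
    Child u v = ⋁ (childAt u v)

    childAt-elim : ∀ u v k → childAt u v k ≡ true →
      hasLevel (inject₁ k) u ≡ true × hasLevel (suc k) v ≡ true × Rel (toℕ k) u v ≡ true
    childAt-elim u v k at =
      let u-at , rest = ∧-elim (hasLevel (inject₁ k) u) at
          v-at , rel  = ∧-elim (hasLevel (suc k) v) rest
      in u-at , v-at , rel

    eval-νF : ∀ v → eval G lb νF (v ∷ []) [] ≡ ⋁ (λ k → hasLevel k v)
    eval-νF v = eval-⋁F G lb (v ∷ []) [] (λ k → lbl (level k) zero)

    eval-μF : ∀ u v → eval G lb μF (u ∷ v ∷ []) [] ≡ Child u v ∨ Child v u
    eval-μF u v = cong₂ _∨_ (eval-childF zero (suc zero)) (eval-childF (suc zero) zero)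
      where
      eval-childF : ∀ x y → eval G lb (childF x y) (u ∷ v ∷ []) [] ≡
                            Child (lookup (u ∷ v ∷ []) x) (lookup (u ∷ v ∷ []) y)
      eval-childF x y = trans (eval-⋁F G lb (u ∷ v ∷ []) [] (childAtF x y)) (⋁-cong λ k →
        cong (λ z → hasLevel (inject₁ k) (lookup (u ∷ v ∷ []) x)
                    ∧ (hasLevel (suc k) (lookup (u ∷ v ∷ []) y) ∧ z))
             (eval-relF lb lb-colour lb-flip (toℕ k) x y (u ∷ v ∷ []) []))

  σ : Transduction
  σ = record { p = #labels ; χ = ⊤F ; ν = νF ; μ = μF ; μ-sym = μF-sym }
    where
    μF-sym : ∀ (G : Graph) (lb : Fin #labels → Fin (n G) → Bool) (u v : Fin (n G)) →
            eval G lb μF (u ∷ v ∷ []) [] ≡ eval G lb μF (v ∷ u ∷ []) []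
    μF-sym G lb u v =
      trans (eval-μF u v) (trans (∨-comm (Child u v) (Child v u)) (sym (eval-μF v u)))
      where open Output G (λ c → lb (encode (colour c))) (λ ℓ c → lb (encode (flip ℓ c))) lb
                        (λ _ _ → refl) (λ _ _ _ → refl)

  module Correctness (r′ : ℕ) (G : Graph) (M : TreeModel m d G)
                     (contains : (M′ : TreeModel m d G) → ContainsRooted (tree M′) (suc r′)) where
    -- any vertex; it roots the canonical tree
    u₀ : Fin (n G)
    u₀ = proj₁ (contains M) (Vec.replicate d zero)

    open Canonical e m G M u₀
    open Padding d r′

    F : Vec (Fin (suc r′)) d → V
    F = proj₁ (contains canonicalModel)

    F-emb : Emb leaves (suc r′) F
    F-emb = proj₂ (contains canonicalModel)

    node : TbarV d r′ → V
    node x = F (padVec x)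

    node-injective : ∀ x y → node x ≡ node y → x ≡ y
    node-injective x y same = padVec-injective x y (proj₁ F-emb (padVec x) (padVec y) same)

    Rel-node : ∀ k → k ≤ e → ∀ x y →
      Rel k (node x) (node y) ≡ true ⇔ drop (d ∸ k) (pad (proj₁ x)) ≡ drop (d ∸ k) (pad (proj₁ y))
    Rel-node k k≤e x y =
      subst₂ (λ a b → Rel k (node x) (node y) ≡ true ⇔ drop (d ∸ k) a ≡ drop (d ∸ k) b)
             (toList-padVec x) (toList-padVec y) (embedded-leaves F F-emb k k≤e (padVec x) (padVec y))

    atLevel : Fin (suc d) → V → TbarV d r′ → Bool
    atLevel k v x = ⌊ length (proj₁ x) ℕₚ.≟ toℕ k ⌋ ∧ ⌊ node x ≟ v ⌋

    levelMark : Fin (suc d) → V → Bool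
    levelMark k v = any (atLevel k v) (nodes d r′)

    levelMark-sound : ∀ k v → levelMark k v ≡ true →
                      ∃ λ x → node x ≡ v × length (proj₁ x) ≡ toℕ k
    levelMark-sound k v h =
      let x , _ , at = any-elim (atLevel k v) {nodes d r′} h
          |x|≡k , x↦v = ∧-elim ⌊ length (proj₁ x) ℕₚ.≟ toℕ k ⌋ at
      in x , dec-true (node x ≟ v) x↦v , dec-true (length (proj₁ x) ℕₚ.≟ toℕ k) |x|≡k

    levelMark-node : ∀ k x → length (proj₁ x) ≡ toℕ k → levelMark k (node x) ≡ true
    levelMark-node k x |x|≡k = any-intro (atLevel k (node x)) (nodes-complete d r′ x)
      (∧-intro (true-dec (length (proj₁ x) ℕₚ.≟ toℕ k) |x|≡k) (true-dec (node x ≟ node x) refl))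

    labelOf : Label → V → Bool
    labelOf (level k)  = levelMark k
    labelOf (colour c) = colourOf c
    labelOf (flip ℓ c) = flipOf ℓ c

    lb : Fin #labels → V → Bool
    lb a = labelOf (decode a)

    lb-encode : ∀ x v → lb (encode x) v ≡ labelOf x v
    lb-encode x v = cong (λ y → labelOf y v) (decode-encode x)

    open Output G colourOf flipOf lb (λ c → lb-encode (colour c)) (λ ℓ c → lb-encode (flip ℓ c))

    hasLevel-node : ∀ k x → hasLevel k (node x) ≡ true ⇔ length (proj₁ x) ≡ toℕ k
    hasLevel-node k x = mk⇔
      (λ h → let y , y↦x , |y|≡k = levelMark-sound k (node x)
                                      (trans (sym (lb-encode (level k) (node x))) h)
             in subst (λ z → length (proj₁ z) ≡ toℕ k) (node-injective y x y↦x) |y|≡k)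
      (λ |x|≡k → trans (lb-encode (level k) (node x)) (levelMark-node k x |x|≡k))

    hasLevel-onto : ∀ k v → hasLevel k v ≡ true → ∃ λ x → node x ≡ v
    hasLevel-onto k v h =
      let x , x↦v , _ = levelMark-sound k v (trans (sym (lb-encode (level k) v)) h) in x , x↦v

    Child-node : ∀ x y → Child (node x) (node y) ≡ isChild (proj₁ x) (proj₁ y)
    Child-node x@(s , _) y@(t , |t|≤d) = bool-ext child⇒ ⇒child
      where
      same-ancestor : ℕ → Set
      same-ancestor i = drop (d ∸ i) (pad s) ≡ drop (d ∸ i) (pad t)

      child-at : ∀ k → hasLevel (inject₁ k) (node x) ≡ true × hasLevel (suc k) (node y) ≡ true ×
                       Rel (toℕ k) (node x) (node y) ≡ true → isChild s t ≡ true
      child-at k (x-at , y-at , rel) = Equivalence.from (child-iff-ancestor s t |t|≡ |t|≤d)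
        (subst same-ancestor (sym |s|≡k)
          (Equivalence.to (Rel-node (toℕ k) (ℕₚ.≤-pred (toℕ<n k)) x y) rel))
        where
        |s|≡k : length s ≡ toℕ k
        |s|≡k = trans (Equivalence.to (hasLevel-node _ x) x-at) (toℕ-inject₁ k)
        |t|≡ : length t ≡ suc (length s)
        |t|≡ = trans (Equivalence.to (hasLevel-node _ y) y-at) (cong suc (sym |s|≡k))

      child⇒ : Child (node x) (node y) ≡ true → isChild s t ≡ true
      child⇒ h = let k , at = ⋁-elim (childAt (node x) (node y)) h
                 in child-at k (childAt-elim (node x) (node y) k at)

      ⇒child : isChild s t ≡ true → Child (node x) (node y) ≡ true
      ⇒child child = ⋁-intro (childAt (node x) (node y)) k (∧-intro x-at (∧-intro y-at rel))
        where
        |t|≡ : length t ≡ suc (length s)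
        |t|≡ = child-length s t child
        |s|<d : suc (length s) ≤ d
        |s|<d = subst (_≤ d) |t|≡ |t|≤d
        k : Fin d
        k = fromℕ< |s|<d
        k≡|s| : toℕ k ≡ length s
        k≡|s| = toℕ-fromℕ< |s|<d
        x-at = Equivalence.from (hasLevel-node _ x) (sym (trans (toℕ-inject₁ k) k≡|s|))
        y-at = Equivalence.from (hasLevel-node _ y) (trans |t|≡ (cong suc (sym k≡|s|)))
        rel = Equivalence.from (Rel-node (toℕ k) (ℕₚ.≤-pred (toℕ<n k)) x y)
                (subst same-ancestor (sym k≡|s|)
                       (Equivalence.to (child-iff-ancestor s t |t|≡ |t|≤d) child))

    node-output : ∀ x → eval G lb νF (node x ∷ []) [] ≡ true
    node-output x@(s , |s|≤d) = trans (eval-νF (node x))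
      (⋁-intro (λ k → hasLevel k (node x)) k
               (Equivalence.from (hasLevel-node k x) (sym (toℕ-fromℕ< (s≤s |s|≤d)))))
      where
      k : Fin (suc d)
      k = fromℕ< (s≤s |s|≤d)

    -- (opaque: only its statement matters, and unfolding the witness search
    -- would make checking the isomorphism laws needlessly expensive)
    opaque
      output-node : ∀ v → eval G lb νF (v ∷ []) [] ≡ true → ∃ λ x → node x ≡ v
      output-node v h =
        let k , at = ⋁-elim (λ k → hasLevel k v) (trans (sym (eval-νF v)) h)
        in hasLevel-onto k v at

    toOut : TbarV d r′ → OutV σ G lb
    toOut x = node x , node-output x

    fromOut : OutV σ G lb → TbarV d r′
    fromOut (v , h) = proj₁ (output-node v h)

    to-from : ∀ w → toOut (fromOut w) ≡ w
    to-from (v , h) = Σ-true-≡ {P = λ w → eval G lb νF (w ∷ []) []} (proj₂ (output-node v h))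

    from-to : ∀ x → fromOut (toOut x) ≡ x
    from-to x = node-injective (fromOut (toOut x)) x (proj₂ (output-node (node x) (node-output x)))

    -- T̄ has no loops, so the output's side condition u ≠ v is harmless.
    distinct-guard : ∀ x y → not ⌊ node x ≟ node y ⌋ ∧ TbarAdj d r′ x y ≡ TbarAdj d r′ x y
    distinct-guard x y with node x ≟ node y
    ... | no _     = refl
    ... | yes same = sym (subst (λ z → TbarAdj d r′ x z ≡ false) (node-injective x y same)
                                (cong₂ _∨_ (not-own-child (proj₁ x)) (not-own-child (proj₁ x))))

    edges : ∀ x y → TbarAdj d r′ x y ≡ OutAdj σ G lb (toOut x) (toOut y)
    edges x y = begin
      TbarAdj d r′ x y
        ≡⟨ sym (distinct-guard x y) ⟩
      not ⌊ node x ≟ node y ⌋ ∧ TbarAdj d r′ x y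
        ≡⟨ cong (not ⌊ node x ≟ node y ⌋ ∧_)
                (sym (cong₂ _∨_ (Child-node x y) (Child-node y x))) ⟩
      not ⌊ node x ≟ node y ⌋ ∧ (Child (node x) (node y) ∨ Child (node y) (node x))
        ≡⟨ cong (not ⌊ node x ≟ node y ⌋ ∧_) (sym (eval-μF (node x) (node y))) ⟩
      OutAdj σ G lb (toOut x) (toOut y) ∎
      where open ≡-Reasoning

    result : InTrans (TbarAdj d r′) σ G
    result = lb , eval-⊤F G lb [] [] , mk↔ₛ′ toOut fromOut to-from from-to , edges

-- Lemma 4.11.  For d = e+1 the transduction is σ_{e,m} above; for r = r′+1
-- its correctness was established for every G all of whose tree-models
-- contain T̄_d^r.
lemma4p11 : (d m : ℕ) → 1 ≤ d → 1 ≤ m →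
    Σ Transduction λ σ →
    (r : ℕ) → 1 ≤ r → (G : Graph) → TreeModel m d G →
    ((M : TreeModel m d G) → ContainsRooted (tree M) r) →
    InTrans (TbarAdj d (r ∸ 1)) σ G
lemma4p11 zero    m () _
lemma4p11 (suc e) m _  _ = Construction.σ e m , correct
  where
  correct : (r : ℕ) → 1 ≤ r → (G : Graph) → TreeModel m (suc e) G →
            ((M : TreeModel m (suc e) G) → ContainsRooted (tree M) r) →
            InTrans (TbarAdj (suc e) (r ∸ 1)) (Construction.σ e m) G
  correct zero      ()
  correct (suc r′) _ G M contains = Construction.Correctness.result e m r′ G M contains
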